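{- (Completeness) Every valid sequent $\Gamma\Rightarrow\Sigma$ is derivable in the sequent calculus $\mathfrak S$.
   Context: Formulas are built from a denumerable set of propositional variables with binary $\wedge,\vee$, unary $\neg,\nabla$ and constants $\bot,\top$. $\mathbb{S}_6$ is the algebra with universe $\{0,\tfrac13,N,B,\tfrac23,1\}$, lattice order $0<\tfrac13<N<\tfrac23<1$, $\tfrac13<B<\tfrac23$, $N,B$ incomparable; $\neg$ swaps $0\leftrightarrow1$, $\tfrac13\leftrightarrow\tfrac23$, fixes $N,B$; $\nabla0=0$, $\nabla x=1$ for $x\ne0$; homomorphisms from formulas send $\bot\mapsto0,\top\mapsto1$. A sequent is $\Gamma\Rightarrow\Sigma$ with $\Gamma,\Sigma$ finite sets of formulas; it is valid iff $h(\bigwedge\Gamma)\le h(\bigvee\Sigma)$ for every homomorphism $h$ into $\mathbb{S}_6$ (empty conjunction $\top$, empty disjunction $\bot$). $\nabla\Sigma=\{\nabla\beta:\beta\in\Sigma\}$. The calculus $\mathfrak S$ has axioms $\alpha\Rightarrow\alpha$; $\bot\Rightarrow$; $\Rightarrow\top$; $\alpha\Rightarrow\nabla\alpha$; $\Rightarrow\nabla\alpha\vee\neg\nabla\alpha$; and rules (premises / conclusion): left weakening $\Gamma\Rightarrow\Sigma$ / $\Gamma,\alpha\Rightarrow\Sigma$; right weakening $\Gamma\Rightarrow\Sigma$ / $\Gamma\Rightarrow\Sigma,\alpha$; cut $\Gamma\Rightarrow\Sigma,\alpha$ and $\alpha,\Gamma\Rightarrow\Sigma$ / $\Gamma\Rightarrow\Sigma$;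 $(\wedge\Rightarrow)$ $\Gamma,\alpha,\beta\Rightarrow\Sigma$ / $\Gamma,\alpha\wedge\beta\Rightarrow\Sigma$; $(\Rightarrow\wedge)$ $\Gamma\Rightarrow\Sigma,\alpha$ and $\Gamma\Rightarrow\Sigma,\beta$ / $\Gamma\Rightarrow\Sigma,\alpha\wedge\beta$; $(\vee\Rightarrow)$ $\Gamma,\alpha\Rightarrow\Sigma$ and $\Gamma,\beta\Rightarrow\Sigma$ / $\Gamma,\alpha\vee\beta\Rightarrow\Sigma$; $(\Rightarrow\vee)$ $\Gamma\Rightarrow\Sigma,\alpha,\beta$ / $\Gamma\Rightarrow\Sigma,\alpha\vee\beta$; $(\neg)$ $\alpha\Rightarrow\beta$ / $\neg\beta\Rightarrow\neg\alpha$; $(\neg\neg\Rightarrow)$ $\Gamma,\alpha\Rightarrow\Sigma$ / $\Gamma,\neg\neg\alpha\Rightarrow\Sigma$; $(\Rightarrow\neg\neg)$ $\Gamma\Rightarrow\alpha,\Sigma$ / $\Gamma\Rightarrow\neg\neg\alpha,\Sigma$; $(\nabla)$ $\Gamma,\alpha\Rightarrow\nabla\Sigma$ / $\Gamma,\nabla\alpha\Rightarrow\nabla\Sigma$; $(\neg\nabla\Rightarrow)$ $\Gamma,\neg\nabla\alpha\Rightarrow\Sigma$ / $\Gamma,\nabla\neg\nabla\alpha\Rightarrow\Sigma$. Derivability is the usual notion (derivation trees from axiom instances using these rules). -}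

module Defs where

open import Data.Nat using (ℕ)
open import Data.Bool using (Bool; true; false; T)
open import Data.List using (List; []; _∷_; foldr; map)
open import Data.List.Membership.Propositional using (_∈_)

infixr 6 _∧'_
infixr 5 _∨'_

data Formula : Set where
  var  : ℕ → Formula
  _∧'_ : Formula → Formula → Formula
  _∨'_ : Formula → Formula → Formula
  ¬'   : Formula → Formula
  ∇'   : Formula → Formula
  ⊥'   : Formula
  ⊤'   : Formula

-- The algebra S6 : 0 < 1/3 < N,B < 2/3 < 1, with N, B incomparable

data S6 : Set where
  s0 s⅓ sN sB s⅔ s1 : S6

leq : S6 → S6 → Bool
leq s0 _   = true
leq s⅓ s0  = false
leq s⅓ _   = true
leq sN s0  = false
leq sN s⅓  = false
leq sN sN  = true
leq sN sB  = false
leq sN _   = true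
leq sB s0  = false
leq sB s⅓  = false
leq sB sN  = false
leq sB sB  = true
leq sB _   = true
leq s⅔ s⅔  = true
leq s⅔ s1  = true
leq s⅔ _   = false
leq s1 s1  = true
leq s1 _   = false

_≤S_ : S6 → S6 → Set
x ≤S y = T (leq x y)

meet : S6 → S6 → S6
meet sN sB = s⅓
meet sB sN = s⅓
meet x y with leq x y
... | true  = x
... | false = y

join : S6 → S6 → S6
join sN sB = s⅔
join sB sN = s⅔
join x y with leq x y
... | true  = y
... | false = x

neg : S6 → S6
neg s0 = s1
neg s⅓ = s⅔
neg sN = sN
neg sB = sB
neg s⅔ = s⅓
neg s1 = s0

nabla : S6 → S6
nabla s0 = s0
nabla _  = s1

eval : (ℕ → S6) → Formula → S6
eval v (var n)  = v n
eval v (a ∧' b) = meet (eval v a) (eval v b)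
eval v (a ∨' b) = join (eval v a) (eval v b)
eval v (¬' a)   = neg (eval v a)
eval v (∇' a)   = nabla (eval v a)
eval v ⊥'       = s0
eval v ⊤'       = s1

-- Sequents: finite sets of formulas, represented by lists taken up to
-- having the same members (rule `set-eq` below).

⋀ : List Formula → Formula
⋀ = foldr _∧'_ ⊤'

⋁ : List Formula → Formula
⋁ = foldr _∨'_ ⊥'

Valid : List Formula → List Formula → Set
Valid Γ Σ = (v : ℕ → S6) → eval v (⋀ Γ) ≤S eval v (⋁ Σ)

_⊆ₛ_ : List Formula → List Formula → Set
xs ⊆ₛ ys = ∀ {a} → a ∈ xs → a ∈ ys

∇s : List Formula → List Formula
∇s = map ∇'

infix 4 _⊢_

data _⊢_ : List Formula → List Formula → Set where
  set-eq : ∀ {Γ Σ Γ' Σ'} → Γ ⊆ₛ Γ' → Γ' ⊆ₛ Γ → Σ ⊆ₛ Σ' → Σ' ⊆ₛ Σ →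
           Γ ⊢ Σ → Γ' ⊢ Σ'
  ax-id     : ∀ α → (α ∷ []) ⊢ (α ∷ [])
  ax-⊥      : (⊥' ∷ []) ⊢ []
  ax-⊤      : [] ⊢ (⊤' ∷ [])
  ax-∇      : ∀ α → (α ∷ []) ⊢ (∇' α ∷ [])
  ax-∇¬∇    : ∀ α → [] ⊢ ((∇' α ∨' ¬' (∇' α)) ∷ [])
  weak-l : ∀ {Γ Σ} α → Γ ⊢ Σ → (α ∷ Γ) ⊢ Σ
  weak-r : ∀ {Γ Σ} α → Γ ⊢ Σ → Γ ⊢ (α ∷ Σ)
  cut    : ∀ {Γ Σ} α → Γ ⊢ (α ∷ Σ) → (α ∷ Γ) ⊢ Σ → Γ ⊢ Σ
  ∧-l  : ∀ {Γ Σ α β} → (α ∷ β ∷ Γ) ⊢ Σ → ((α ∧' β) ∷ Γ) ⊢ Σ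
  ∧-r  : ∀ {Γ Σ α β} → Γ ⊢ (α ∷ Σ) → Γ ⊢ (β ∷ Σ) → Γ ⊢ ((α ∧' β) ∷ Σ)
  ∨-l  : ∀ {Γ Σ α β} → (α ∷ Γ) ⊢ Σ → (β ∷ Γ) ⊢ Σ → ((α ∨' β) ∷ Γ) ⊢ Σ
  ∨-r  : ∀ {Γ Σ α β} → Γ ⊢ (α ∷ β ∷ Σ) → Γ ⊢ ((α ∨' β) ∷ Σ)
  ¬-rule : ∀ {α β} → (α ∷ []) ⊢ (β ∷ []) → (¬' β ∷ []) ⊢ (¬' α ∷ [])
  ¬¬-l : ∀ {Γ Σ α} → (α ∷ Γ) ⊢ Σ → (¬' (¬' α) ∷ Γ) ⊢ Σ
  ¬¬-r : ∀ {Γ Σ α} → Γ ⊢ (α ∷ Σ) → Γ ⊢ (¬' (¬' α) ∷ Σ)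
  ∇-rule : ∀ {Γ Σ α} → (α ∷ Γ) ⊢ ∇s Σ → (∇' α ∷ Γ) ⊢ ∇s Σ
  ¬∇-l : ∀ {Γ Σ α} → (¬' (∇' α) ∷ Γ) ⊢ Σ → (∇' (¬' (∇' α)) ∷ Γ) ⊢ Σ

-- Call N, ⅔ and 1 designated. This is a prime filter of S6, so designation
-- commutes with ∧ and ∨, and on formulas of the form ∇a the negation acts on it
-- as Boolean negation. Every formula is interderivable with, and has the same
-- value as, a negation normal form over the literals p, ¬p, ∇p, ∇¬p, ¬∇p, ¬∇¬p,
-- and by the axiom ⊢ ∇a ∨ ¬∇a the literals ¬∇p, ¬∇¬p may be moved across the
-- sequent arrow as ∇p, ∇¬p. Invertible proof search thus reduces Γ ⇒ Σ to
-- sequents of literals p, ¬p, ∇p, ∇¬p, each of which is either an axiom up to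
-- weakening or refuted by a valuation designating its left side and none of its
-- right side. A refuted sequent is not valid, designation being upward closed.
module Submission where

open import Defs
open import Data.Bool using (Bool; true; false; not; _∧_; _∨_)
open import Data.Bool.Properties using (∧-zeroʳ; ∨-zeroʳ; ¬-not)
open import Data.Empty using (⊥-elim)
open import Data.Fin using () renaming (_≟_ to _≟ᶠ_)
open import Data.List using (List; []; _∷_; [_]; _++_; map; cartesianProduct; lookup)
open import Data.List.Membership.Propositional using (_∈_; lose; find)
open import Data.List.Membership.Propositional.Properties
  using (∈-++⁺ˡ; ∈-++⁻; ∈-map⁺; ∈-cartesianProduct⁺)
open import Data.List.Properties using (map-++; ++-assoc; ++-identityʳ)
open import Data.List.Relation.Binary.Permutation.Propositional using (_↭_; ↭-refl; ↭-sym)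
open import Data.List.Relation.Binary.Permutation.Propositional.Properties
  using (∈-resp-↭; All-resp-↭; shift)
open import Data.List.Relation.Binary.Subset.Propositional.Properties using (xs⊆x∷xs; ∷⁺ʳ)
open import Data.List.Relation.Unary.All as All using (All; []; _∷_; all?)
open import Data.List.Relation.Unary.All.Properties using (map⁺)
open import Data.List.Relation.Unary.Any using (here; there; index; satisfied; any?)
open import Data.List.Relation.Unary.Any.Properties using (lookup-index)
open import Data.Nat using (ℕ) renaming (_≟_ to _≟ℕ_)
open import Data.Product using (_×_; _,_; proj₁; proj₂; ∃)
open import Data.Product.Properties using (≡-dec)
open import Data.Sum as Sum using (_⊎_; inj₁; inj₂; fromInj₁)
open import Function using (id)
open import Relation.Binary.Definitions using (DecidableEquality)
open import Relation.Binary.PropositionalEquality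
  using (_≡_; refl; sym; trans; cong; cong₂; subst₂; module ≡-Reasoning)
open import Relation.Nullary using (¬_; yes; no; does)
open import Relation.Nullary.Decidable using (True; toWitness; map′; dec-true; _→-dec_; T?)
open import Relation.Unary using (Decidable)

private variable
  a b c : Formula
  Γ Γ' Σ Σ' : List Formula

record Enumerable (A : Set) : Set where
  field
    elements : List A
    complete : ∀ x → x ∈ elements

open Enumerable ⦃ ... ⦄

module _ {A : Set} ⦃ _ : Enumerable A ⦄ where

  by-exhaustion : {P : A → Set} (P? : Decidable P) {_ : True (all? P? elements)} → ∀ x → P x
  by-exhaustion P? {all} x = All.lookup (toWitness all) (complete x)

  infix 4 _≟_
  _≟_ : DecidableEquality A
  x ≟ y = map′ index-injective (cong (λ z → index (complete z))) (index (complete x) ≟ᶠ index (complete y))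
    where
    index-injective : index (complete x) ≡ index (complete y) → x ≡ y
    index-injective eq =
      trans (lookup-index (complete x)) (trans (cong (lookup elements) eq) (sym (lookup-index (complete y))))

instance
  Bool-enumerable : Enumerable Bool
  Bool-enumerable = record
    { elements = false ∷ true ∷ []
    ; complete = λ { false → here refl ; true → there (here refl) } }

  S6-enumerable : Enumerable S6
  S6-enumerable = record
    { elements = s0 ∷ s⅓ ∷ sN ∷ sB ∷ s⅔ ∷ s1 ∷ []
    ; complete = λ { s0 → here refl ; s⅓ → there (here refl) ; sN → there (there (here refl))
                   ; sB → there (there (there (here refl)))
                   ; s⅔ → there (there (there (there (here refl))))
                   ; s1 → there (there (there (there (there (here refl))))) } }

  ×-enumerable : {A B : Set} → ⦃ Enumerable A ⦄ → ⦃ Enumerable B ⦄ → Enumerable (A × B)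
  ×-enumerable = record
    { elements = cartesianProduct elements elements
    ; complete = λ (x , y) → ∈-cartesianProduct⁺ (complete x) (complete y) }

neg-involutive : ∀ x → neg (neg x) ≡ x
neg-involutive = by-exhaustion λ x → neg (neg x) ≟ x

nabla-idempotent : ∀ x → nabla (nabla x) ≡ nabla x
nabla-idempotent = by-exhaustion λ x → nabla (nabla x) ≟ nabla x

nabla-neg-nabla : ∀ x → nabla (neg (nabla x)) ≡ neg (nabla x)
nabla-neg-nabla = by-exhaustion λ x → nabla (neg (nabla x)) ≟ neg (nabla x)

neg-meet : ∀ x y → neg (meet x y) ≡ join (neg x) (neg y)
neg-meet x y = by-exhaustion (λ (x , y) → neg (meet x y) ≟ join (neg x) (neg y)) (x , y)

neg-join : ∀ x y → neg (join x y) ≡ meet (neg x) (neg y)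
neg-join x y = by-exhaustion (λ (x , y) → neg (join x y) ≟ meet (neg x) (neg y)) (x , y)

nabla-meet : ∀ x y → nabla (meet x y) ≡ meet (nabla x) (nabla y)
nabla-meet x y = by-exhaustion (λ (x , y) → nabla (meet x y) ≟ meet (nabla x) (nabla y)) (x , y)

nabla-join : ∀ x y → nabla (join x y) ≡ join (nabla x) (nabla y)
nabla-join x y = by-exhaustion (λ (x , y) → nabla (join x y) ≟ join (nabla x) (nabla y)) (x , y)

designated : S6 → Bool
designated sN = true
designated s⅔ = true
designated s1 = true
designated _  = false

designated-meet : ∀ x y → designated (meet x y) ≡ designated x ∧ designated y
designated-meet x y = by-exhaustion (λ (x , y) → designated (meet x y) ≟ designated x ∧ designated y) (x , y)

designated-join : ∀ x y → designated (join x y) ≡ designated x ∨ designated y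
designated-join x y = by-exhaustion (λ (x , y) → designated (join x y) ≟ designated x ∨ designated y) (x , y)

designated-neg-nabla : ∀ x → designated (neg (nabla x)) ≡ not (designated (nabla x))
designated-neg-nabla = by-exhaustion λ x → designated (neg (nabla x)) ≟ not (designated (nabla x))

designated-mono : ∀ x y → x ≤S y → designated x ≡ true → designated y ≡ true
designated-mono x y =
  by-exhaustion (λ (x , y) → T? (leq x y) →-dec designated x ≟ true →-dec designated y ≟ true) (x , y)

-- Derived rules

infix 4 _⊢₁_ _⊣⊢_

_⊢₁_ : Formula → Formula → Set
a ⊢₁ b = [ a ] ⊢ [ b ]

_⊣⊢_ : Formula → Formula → Set
a ⊣⊢ b = a ⊢₁ b × b ⊢₁ a

weakenˡ-++ : (Δ : List Formula) → Γ ⊢ Σ → Δ ++ Γ ⊢ Σ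
weakenˡ-++ []      d = d
weakenˡ-++ (a ∷ Δ) d = weak-l a (weakenˡ-++ Δ d)

weakenʳ-++ : (Δ : List Formula) → Γ ⊢ Σ → Γ ⊢ Δ ++ Σ
weakenʳ-++ []      d = d
weakenʳ-++ (a ∷ Δ) d = weak-r a (weakenʳ-++ Δ d)

weaken : Γ ⊆ₛ Γ' → Σ ⊆ₛ Σ' → Γ ⊢ Σ → Γ' ⊢ Σ'
weaken {Γ' = Γ'} {Σ' = Σ'} Γ⊆Γ' Σ⊆Σ' d =
  set-eq (absorb Γ⊆Γ') ∈-++⁺ˡ (absorb Σ⊆Σ') ∈-++⁺ˡ (weakenʳ-++ Σ' (weakenˡ-++ Γ' d))
  where
  absorb : {xs ys : List Formula} → xs ⊆ₛ ys → (ys ++ xs) ⊆ₛ ys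
  absorb {ys = ys} xs⊆ys a∈ = Sum.[ id , xs⊆ys ] (∈-++⁻ ys a∈)

single⊆ : {xs : List Formula} → a ∈ xs → [ a ] ⊆ₛ xs
single⊆ a∈xs (here refl) = a∈xs

pair⊆ : {xs : List Formula} → a ∈ xs → b ∈ xs → (a ∷ b ∷ []) ⊆ₛ xs
pair⊆ a∈xs b∈xs (here refl)         = a∈xs
pair⊆ a∈xs b∈xs (there (here refl)) = b∈xs

weaken₁ : a ∈ Γ → b ∈ Σ → a ⊢₁ b → Γ ⊢ Σ
weaken₁ a∈Γ b∈Σ = weaken (single⊆ a∈Γ) (single⊆ b∈Σ)

⊢-resp-↭ : Γ ↭ Γ' → Σ ↭ Σ' → Γ ⊢ Σ → Γ' ⊢ Σ'
⊢-resp-↭ Γ↭Γ' Σ↭Σ' = weaken (∈-resp-↭ Γ↭Γ') (∈-resp-↭ Σ↭Σ')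

cutˡ : a ⊢₁ b → b ∷ Γ ⊢ Σ → a ∷ Γ ⊢ Σ
cutˡ {a = a} {b = b} {Γ = Γ} a⊢b d =
  cut b (weaken₁ (here refl) (here refl) a⊢b) (weaken (∷⁺ʳ b (xs⊆x∷xs Γ a)) id d)

cutʳ : a ⊢₁ b → Γ ⊢ a ∷ Σ → Γ ⊢ b ∷ Σ
cutʳ {a = a} {b = b} {Σ = Σ} a⊢b d =
  cut a (weaken id (∷⁺ʳ a (xs⊆x∷xs Σ b)) d) (weaken₁ (here refl) (here refl) a⊢b)

⊢₁-trans : a ⊢₁ b → b ⊢₁ c → a ⊢₁ c
⊢₁-trans a⊢b b⊢c = cutʳ b⊢c a⊢b

⊣⊢-refl : a ⊣⊢ a
⊣⊢-refl = ax-id _ , ax-id _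

⊣⊢-trans : a ⊣⊢ b → b ⊣⊢ c → a ⊣⊢ c
⊣⊢-trans (a⊢b , b⊢a) (b⊢c , c⊢b) = ⊢₁-trans a⊢b b⊢c , ⊢₁-trans c⊢b b⊢a

⊥-elimʳ : Γ ⊢ [ ⊥' ] → Γ ⊢ []
⊥-elimʳ d = cut ⊥' d (weaken (single⊆ (here refl)) (λ ()) ax-⊥)

¬¬-intro : a ⊢₁ ¬' (¬' a)
¬¬-intro = ¬¬-r (ax-id _)

¬¬-elim : ¬' (¬' a) ⊢₁ a
¬¬-elim = ¬¬-l (ax-id _)

¬¬ : ¬' (¬' a) ⊣⊢ a
¬¬ = ¬¬-elim , ¬¬-intro

¬-cong : a ⊣⊢ b → ¬' a ⊣⊢ ¬' b
¬-cong (a⊢b , b⊢a) = ¬-rule b⊢a , ¬-rule a⊢b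

∇-mono : a ⊢₁ b → ∇' a ⊢₁ ∇' b
∇-mono {b = b} a⊢b = ∇-rule {Σ = [ b ]} (⊢₁-trans a⊢b (ax-∇ b))

∇-cong : a ⊣⊢ b → ∇' a ⊣⊢ ∇' b
∇-cong (a⊢b , b⊢a) = ∇-mono a⊢b , ∇-mono b⊢a

∧-elimˡ : a ∧' b ⊢₁ a
∧-elimˡ = ∧-l (weaken₁ (here refl) (here refl) (ax-id _))

∧-elimʳ : a ∧' b ⊢₁ b
∧-elimʳ = ∧-l (weaken₁ (there (here refl)) (here refl) (ax-id _))

∨-introˡ : a ⊢₁ a ∨' b
∨-introˡ = ∨-r (weaken₁ (here refl) (here refl) (ax-id _))

∨-introʳ : b ⊢₁ a ∨' b
∨-introʳ = ∨-r (weaken₁ (here refl) (there (here refl)) (ax-id _))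

∧-cong : {a' b' : Formula} → a ⊣⊢ a' → b ⊣⊢ b' → a ∧' b ⊣⊢ a' ∧' b'
∧-cong (a⊢a' , a'⊢a) (b⊢b' , b'⊢b) =
  ∧-r (⊢₁-trans ∧-elimˡ a⊢a') (⊢₁-trans ∧-elimʳ b⊢b') ,
  ∧-r (⊢₁-trans ∧-elimˡ a'⊢a) (⊢₁-trans ∧-elimʳ b'⊢b)

∨-cong : {a' b' : Formula} → a ⊣⊢ a' → b ⊣⊢ b' → a ∨' b ⊣⊢ a' ∨' b'
∨-cong (a⊢a' , a'⊢a) (b⊢b' , b'⊢b) =
  ∨-l (⊢₁-trans a⊢a' ∨-introˡ) (⊢₁-trans b⊢b' ∨-introʳ) ,
  ∨-l (⊢₁-trans a'⊢a ∨-introˡ) (⊢₁-trans b'⊢b ∨-introʳ)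

¬-∧ : ¬' (a ∧' b) ⊣⊢ ¬' a ∨' ¬' b
¬-∧ = ⊢₁-trans (¬-rule (∧-r (⊢₁-trans (¬-rule ∨-introˡ) ¬¬-elim) (⊢₁-trans (¬-rule ∨-introʳ) ¬¬-elim)))
               ¬¬-elim
    , ∨-l (¬-rule ∧-elimˡ) (¬-rule ∧-elimʳ)

¬-∨ : ¬' (a ∨' b) ⊣⊢ ¬' a ∧' ¬' b
¬-∨ = ∧-r (¬-rule ∨-introˡ) (¬-rule ∨-introʳ)
    , ⊢₁-trans ¬¬-intro
        (¬-rule (∨-l (⊢₁-trans ¬¬-intro (¬-rule ∧-elimˡ)) (⊢₁-trans ¬¬-intro (¬-rule ∧-elimʳ))))

¬-⊤ : ¬' ⊤' ⊣⊢ ⊥'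
¬-⊤ = ⊢₁-trans (¬-rule (weak-l _ ax-⊤)) ¬¬-elim , weak-r _ ax-⊥

¬-⊥ : ¬' ⊥' ⊣⊢ ⊤'
¬-⊥ = weak-l _ ax-⊤ , ⊢₁-trans ¬¬-intro (¬-rule (weak-r _ ax-⊥))

∇-∧ : ∇' (a ∧' b) ⊣⊢ ∇' a ∧' ∇' b
∇-∧ {a = a} {b = b} =
  ∧-r (∇-mono ∧-elimˡ) (∇-mono ∧-elimʳ) ,
  ∧-l (∇-rule {Σ = [ a ∧' b ]} (weaken (pair⊆ (there (here refl)) (here refl)) id
        (∇-rule {Σ = [ a ∧' b ]} (cutʳ (ax-∇ _)
          (∧-r (weaken₁ (there (here refl)) (here refl) (ax-id a)) (weaken₁ (here refl) (here refl) (ax-id b)))))))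

∇-∨ : ∇' (a ∨' b) ⊣⊢ ∇' a ∨' ∇' b
∇-∨ {a = a} {b = b} =
  ∨-r (∇-rule {Σ = a ∷ b ∷ []}
        (∨-l (weaken₁ (here refl) (here refl) (ax-∇ a)) (weaken₁ (here refl) (there (here refl)) (ax-∇ b)))) ,
  ∨-l (∇-mono ∨-introˡ) (∇-mono ∨-introʳ)

∇-∇ : ∇' (∇' a) ⊣⊢ ∇' a
∇-∇ {a = a} = ∇-rule {Σ = [ a ]} (ax-id _) , ax-∇ _

∇-⊥ : ∇' ⊥' ⊣⊢ ⊥'
∇-⊥ = weak-r _ (∇-rule {Σ = []} ax-⊥) , ax-∇ _

∇-⊤ : ∇' ⊤' ⊣⊢ ⊤'
∇-⊤ = weak-l _ ax-⊤ , ax-∇ _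

∇-¬∇ : ∇' (¬' (∇' a)) ⊣⊢ ¬' (∇' a)
∇-¬∇ = ¬∇-l (ax-id _) , ax-∇ _

∇-excluded-middle : [] ⊢ ∇' a ∷ ¬' (∇' a) ∷ []
∇-excluded-middle {a = a} =
  cut (∇' a ∨' ¬' (∇' a)) (weaken (λ ()) (single⊆ (here refl)) (ax-∇¬∇ a))
      (∨-l (weaken₁ (here refl) (here refl) (ax-id _)) (weaken₁ (here refl) (there (here refl)) (ax-id _)))

-- ∇a, ¬∇a ⊢ ¬∇a ∧ ¬¬∇a ⊢ ¬(∇a ∨ ¬∇a) ⊢ ¬⊤ ⊢ ⊥
∇-noncontradiction : ∇' a ∷ ¬' (∇' a) ∷ [] ⊢ []
∇-noncontradiction {a = a} = ⊥-elimʳ (cutʳ refute-excluded-middle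
  (∧-r (weaken₁ (there (here refl)) (here refl) (ax-id _)) (weaken₁ (here refl) (here refl) ¬¬-intro)))
  where
  refute-excluded-middle : ¬' (∇' a) ∧' ¬' (¬' (∇' a)) ⊢₁ ⊥'
  refute-excluded-middle = ⊢₁-trans (proj₂ ¬-∨) (⊢₁-trans (¬-rule (weak-l _ (ax-∇¬∇ a))) (proj₁ ¬-⊤))

¬∇-left : Γ ⊢ ∇' a ∷ Σ → ¬' (∇' a) ∷ Γ ⊢ Σ
¬∇-left d = cut _ (weaken there id d)
                  (weaken (pair⊆ (here refl) (there (here refl))) (λ ()) ∇-noncontradiction)

¬∇-right : ∇' a ∷ Γ ⊢ Σ → Γ ⊢ ¬' (∇' a) ∷ Σ
¬∇-right d = cut _ (weaken (λ ()) (pair⊆ (here refl) (there (here refl))) ∇-excluded-middle)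
                   (weaken id there d)

∇-or : ¬' (∇' a) ⊢₁ c → [] ⊢ ∇' a ∷ c ∷ []
∇-or d = cut _ (weaken (λ ()) (pair⊆ (there (here refl)) (here refl)) ∇-excluded-middle)
               (weaken₁ (here refl) (there (here refl)) d)

⊢-∇-¬ : [] ⊢ ∇' a ∷ ¬' a ∷ []
⊢-∇-¬ = ∇-or (¬-rule (ax-∇ _))

⊢-∇-∇¬ : [] ⊢ ∇' a ∷ ∇' (¬' a) ∷ []
⊢-∇-∇¬ = ∇-or (⊢₁-trans (¬-rule (ax-∇ _)) (ax-∇ _))

⊢-∇¬-id : [] ⊢ ∇' (¬' a) ∷ a ∷ []
⊢-∇¬-id = ∇-or (⊢₁-trans (¬-rule (ax-∇ _)) ¬¬-elim)

-- Negation normal forms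

data Kind : Set where
  atom ¬atom ∇atom ∇¬atom : Kind

instance
  Kind-enumerable : Enumerable Kind
  Kind-enumerable = record
    { elements = atom ∷ ¬atom ∷ ∇atom ∷ ∇¬atom ∷ []
    ; complete = λ { atom → here refl ; ¬atom → there (here refl) ; ∇atom → there (there (here refl))
                   ; ∇¬atom → there (there (there (here refl))) } }

Lit : Set
Lit = Kind × ℕ

litF : Lit → Formula
litF (atom   , n) = var n
litF (¬atom  , n) = ¬' (var n)
litF (∇atom  , n) = ∇' (var n)
litF (∇¬atom , n) = ∇' (¬' (var n))

lits : List Lit → List Formula
lits = map litF

evalKind : Kind → S6 → S6
evalKind atom   x = x
evalKind ¬atom  x = neg x
evalKind ∇atom  x = nabla x
evalKind ∇¬atom x = nabla (neg x)

eval-litF : ∀ v k n → eval v (litF (k , n)) ≡ evalKind k (v n)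
eval-litF v atom   n = refl
eval-litF v ¬atom  n = refl
eval-litF v ∇atom  n = refl
eval-litF v ∇¬atom n = refl

infixr 6 _∧ₙ_
infixr 5 _∨ₙ_

data NNF : Set where
  lit             : Lit → NNF
  ¬∇atom ¬∇¬atom  : ℕ → NNF
  _∧ₙ_ _∨ₙ_       : NNF → NNF → NNF
  ⊤ₙ ⊥ₙ           : NNF

⌊_⌋ : NNF → Formula
⌊ lit l ⌋       = litF l
⌊ ¬∇atom n ⌋    = ¬' (∇' (var n))
⌊ ¬∇¬atom n ⌋   = ¬' (∇' (¬' (var n)))
⌊ x ∧ₙ y ⌋      = ⌊ x ⌋ ∧' ⌊ y ⌋
⌊ x ∨ₙ y ⌋      = ⌊ x ⌋ ∨' ⌊ y ⌋
⌊ ⊤ₙ ⌋          = ⊤'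
⌊ ⊥ₙ ⌋          = ⊥'

¬ₙ : NNF → NNF
¬ₙ (lit (atom   , n)) = lit (¬atom , n)
¬ₙ (lit (¬atom  , n)) = lit (atom , n)
¬ₙ (lit (∇atom  , n)) = ¬∇atom n
¬ₙ (lit (∇¬atom , n)) = ¬∇¬atom n
¬ₙ (¬∇atom n)         = lit (∇atom , n)
¬ₙ (¬∇¬atom n)         = lit (∇¬atom , n)
¬ₙ (x ∧ₙ y)           = ¬ₙ x ∨ₙ ¬ₙ y
¬ₙ (x ∨ₙ y)           = ¬ₙ x ∧ₙ ¬ₙ y
¬ₙ ⊤ₙ                 = ⊥ₙ
¬ₙ ⊥ₙ                 = ⊤ₙ

nnf nnf∇ nnf∇¬ : Formula → NNF
nnf (var n)    = lit (atom , n)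
nnf (a ∧' b)   = nnf a ∧ₙ nnf b
nnf (a ∨' b)   = nnf a ∨ₙ nnf b
nnf (¬' a)     = ¬ₙ (nnf a)
nnf (∇' a)     = nnf∇ a
nnf ⊥'         = ⊥ₙ
nnf ⊤'         = ⊤ₙ
nnf∇ (var n)   = lit (∇atom , n)
nnf∇ (a ∧' b)  = nnf∇ a ∧ₙ nnf∇ b
nnf∇ (a ∨' b)  = nnf∇ a ∨ₙ nnf∇ b
nnf∇ (¬' a)    = nnf∇¬ a
nnf∇ (∇' a)    = nnf∇ a
nnf∇ ⊥'        = ⊥ₙ
nnf∇ ⊤'        = ⊤ₙ
nnf∇¬ (var n)  = lit (∇¬atom , n)
nnf∇¬ (a ∧' b) = nnf∇¬ a ∨ₙ nnf∇¬ b
nnf∇¬ (a ∨' b) = nnf∇¬ a ∧ₙ nnf∇¬ b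
nnf∇¬ (¬' a)   = nnf∇ a
nnf∇¬ (∇' a)   = ¬ₙ (nnf∇ a)
nnf∇¬ ⊥'       = ⊤ₙ
nnf∇¬ ⊤'       = ⊥ₙ

¬ₙ-equiv : ∀ x → ¬' ⌊ x ⌋ ⊣⊢ ⌊ ¬ₙ x ⌋
¬ₙ-equiv (lit (atom   , n)) = ⊣⊢-refl
¬ₙ-equiv (lit (¬atom  , n)) = ¬¬
¬ₙ-equiv (lit (∇atom  , n)) = ⊣⊢-refl
¬ₙ-equiv (lit (∇¬atom , n)) = ⊣⊢-refl
¬ₙ-equiv (¬∇atom n)         = ¬¬
¬ₙ-equiv (¬∇¬atom n)         = ¬¬
¬ₙ-equiv (x ∧ₙ y)           = ⊣⊢-trans ¬-∧ (∨-cong (¬ₙ-equiv x) (¬ₙ-equiv y))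
¬ₙ-equiv (x ∨ₙ y)           = ⊣⊢-trans ¬-∨ (∧-cong (¬ₙ-equiv x) (¬ₙ-equiv y))
¬ₙ-equiv ⊤ₙ                 = ¬-⊤
¬ₙ-equiv ⊥ₙ                 = ¬-⊥

nnf-equiv   : ∀ a → a ⊣⊢ ⌊ nnf a ⌋
nnf∇-equiv  : ∀ a → ∇' a ⊣⊢ ⌊ nnf∇ a ⌋
nnf∇¬-equiv : ∀ a → ∇' (¬' a) ⊣⊢ ⌊ nnf∇¬ a ⌋
nnf-equiv (var n)    = ⊣⊢-refl
nnf-equiv (a ∧' b)   = ∧-cong (nnf-equiv a) (nnf-equiv b)
nnf-equiv (a ∨' b)   = ∨-cong (nnf-equiv a) (nnf-equiv b)
nnf-equiv (¬' a)     = ⊣⊢-trans (¬-cong (nnf-equiv a)) (¬ₙ-equiv (nnf a))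
nnf-equiv (∇' a)     = nnf∇-equiv a
nnf-equiv ⊥'         = ⊣⊢-refl
nnf-equiv ⊤'         = ⊣⊢-refl
nnf∇-equiv (var n)   = ⊣⊢-refl
nnf∇-equiv (a ∧' b)  = ⊣⊢-trans ∇-∧ (∧-cong (nnf∇-equiv a) (nnf∇-equiv b))
nnf∇-equiv (a ∨' b)  = ⊣⊢-trans ∇-∨ (∨-cong (nnf∇-equiv a) (nnf∇-equiv b))
nnf∇-equiv (¬' a)    = nnf∇¬-equiv a
nnf∇-equiv (∇' a)    = ⊣⊢-trans ∇-∇ (nnf∇-equiv a)
nnf∇-equiv ⊥'        = ∇-⊥
nnf∇-equiv ⊤'        = ∇-⊤
nnf∇¬-equiv (var n)  = ⊣⊢-refl
nnf∇¬-equiv (a ∧' b) = ⊣⊢-trans (∇-cong ¬-∧) (⊣⊢-trans ∇-∨ (∨-cong (nnf∇¬-equiv a) (nnf∇¬-equiv b)))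
nnf∇¬-equiv (a ∨' b) = ⊣⊢-trans (∇-cong ¬-∨) (⊣⊢-trans ∇-∧ (∧-cong (nnf∇¬-equiv a) (nnf∇¬-equiv b)))
nnf∇¬-equiv (¬' a)   = ⊣⊢-trans (∇-cong ¬¬) (nnf∇-equiv a)
nnf∇¬-equiv (∇' a)   = ⊣⊢-trans ∇-¬∇ (⊣⊢-trans (¬-cong (nnf∇-equiv a)) (¬ₙ-equiv (nnf∇ a)))
nnf∇¬-equiv ⊥'       = ⊣⊢-trans (∇-cong ¬-⊥) ∇-⊤
nnf∇¬-equiv ⊤'       = ⊣⊢-trans (∇-cong ¬-⊤) ∇-⊥

module _ (v : ℕ → S6) where
  open ≡-Reasoning

  eval-¬ₙ : ∀ x → eval v ⌊ ¬ₙ x ⌋ ≡ neg (eval v ⌊ x ⌋)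
  eval-¬ₙ (lit (atom   , n)) = refl
  eval-¬ₙ (lit (¬atom  , n)) = sym (neg-involutive _)
  eval-¬ₙ (lit (∇atom  , n)) = refl
  eval-¬ₙ (lit (∇¬atom , n)) = refl
  eval-¬ₙ (¬∇atom n)         = sym (neg-involutive _)
  eval-¬ₙ (¬∇¬atom n)         = sym (neg-involutive _)
  eval-¬ₙ (x ∧ₙ y)           =
    trans (cong₂ join (eval-¬ₙ x) (eval-¬ₙ y)) (sym (neg-meet (eval v ⌊ x ⌋) (eval v ⌊ y ⌋)))
  eval-¬ₙ (x ∨ₙ y)           =
    trans (cong₂ meet (eval-¬ₙ x) (eval-¬ₙ y)) (sym (neg-join (eval v ⌊ x ⌋) (eval v ⌊ y ⌋)))
  eval-¬ₙ ⊤ₙ                 = refl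
  eval-¬ₙ ⊥ₙ                 = refl

  eval-nnf   : ∀ a → eval v ⌊ nnf a ⌋ ≡ eval v a
  eval-nnf∇  : ∀ a → eval v ⌊ nnf∇ a ⌋ ≡ nabla (eval v a)
  eval-nnf∇¬ : ∀ a → eval v ⌊ nnf∇¬ a ⌋ ≡ nabla (neg (eval v a))
  eval-nnf (var n)    = refl
  eval-nnf (a ∧' b)   = cong₂ meet (eval-nnf a) (eval-nnf b)
  eval-nnf (a ∨' b)   = cong₂ join (eval-nnf a) (eval-nnf b)
  eval-nnf (¬' a)     = trans (eval-¬ₙ (nnf a)) (cong neg (eval-nnf a))
  eval-nnf (∇' a)     = eval-nnf∇ a
  eval-nnf ⊥'         = refl
  eval-nnf ⊤'         = refl
  eval-nnf∇ (var n)   = refl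
  eval-nnf∇ (a ∧' b)  = trans (cong₂ meet (eval-nnf∇ a) (eval-nnf∇ b)) (sym (nabla-meet (eval v a) (eval v b)))
  eval-nnf∇ (a ∨' b)  = trans (cong₂ join (eval-nnf∇ a) (eval-nnf∇ b)) (sym (nabla-join (eval v a) (eval v b)))
  eval-nnf∇ (¬' a)    = eval-nnf∇¬ a
  eval-nnf∇ (∇' a)    = trans (eval-nnf∇ a) (sym (nabla-idempotent (eval v a)))
  eval-nnf∇ ⊥'        = refl
  eval-nnf∇ ⊤'        = refl
  eval-nnf∇¬ (var n)  = refl
  eval-nnf∇¬ (a ∧' b) = begin
    join (eval v ⌊ nnf∇¬ a ⌋) (eval v ⌊ nnf∇¬ b ⌋) ≡⟨ cong₂ join (eval-nnf∇¬ a) (eval-nnf∇¬ b) ⟩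
    join (nabla (neg x)) (nabla (neg y))           ≡⟨ nabla-join (neg x) (neg y) ⟨
    nabla (join (neg x) (neg y))                   ≡⟨ cong nabla (neg-meet x y) ⟨
    nabla (neg (meet x y))                         ∎
    where x = eval v a; y = eval v b
  eval-nnf∇¬ (a ∨' b) = begin
    meet (eval v ⌊ nnf∇¬ a ⌋) (eval v ⌊ nnf∇¬ b ⌋) ≡⟨ cong₂ meet (eval-nnf∇¬ a) (eval-nnf∇¬ b) ⟩
    meet (nabla (neg x)) (nabla (neg y))           ≡⟨ nabla-meet (neg x) (neg y) ⟨
    nabla (meet (neg x) (neg y))                   ≡⟨ cong nabla (neg-join x y) ⟨
    nabla (neg (join x y))                         ∎
    where x = eval v a; y = eval v b
  eval-nnf∇¬ (¬' a)   = trans (eval-nnf∇ a) (cong nabla (sym (neg-involutive (eval v a))))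
  eval-nnf∇¬ (∇' a)   =
    trans (eval-¬ₙ (nnf∇ a)) (trans (cong neg (eval-nnf∇ a)) (sym (nabla-neg-nabla (eval v a))))
  eval-nnf∇¬ ⊥'       = refl
  eval-nnf∇¬ ⊤'       = refl

-- Decided sequents

holds : (ℕ → S6) → Formula → Bool
holds v a = designated (eval v a)

Refutable : List Formula → List Formula → Set
Refutable Γ Σ = ∃ λ v → All (λ a → holds v a ≡ true) Γ × All (λ a → holds v a ≡ false) Σ

holds-∧ : ∀ v a b → holds v (a ∧' b) ≡ holds v a ∧ holds v b
holds-∧ v a b = designated-meet (eval v a) (eval v b)

holds-∨ : ∀ v a b → holds v (a ∨' b) ≡ holds v a ∨ holds v b
holds-∨ v a b = designated-join (eval v a) (eval v b)

holds-¬∇ : ∀ v a → holds v (¬' (∇' a)) ≡ not (holds v (∇' a))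
holds-¬∇ v a = designated-neg-nabla (eval v a)

holds-⋀ : ∀ {v Γ} → All (λ a → holds v a ≡ true) Γ → holds v (⋀ Γ) ≡ true
holds-⋀ []       = refl
holds-⋀ {v} {a ∷ Γ} (h ∷ hs) = trans (holds-∧ v a (⋀ Γ)) (cong₂ _∧_ h (holds-⋀ hs))

holds-⋁ : ∀ {v Σ} → All (λ a → holds v a ≡ false) Σ → holds v (⋁ Σ) ≡ false
holds-⋁ []       = refl
holds-⋁ {v} {a ∷ Σ} (h ∷ hs) = trans (holds-∨ v a (⋁ Σ)) (cong₂ _∨_ h (holds-⋁ hs))

refutable⇒invalid : Refutable Γ Σ → ¬ Valid Γ Σ
refutable⇒invalid (v , Γ-true , Σ-false) valid
  with () ← trans (sym (designated-mono _ _ (valid v) (holds-⋀ Γ-true))) (holds-⋁ Σ-false)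

Decided : List Formula → List Formula → Set
Decided Γ Σ = Γ ⊢ Σ ⊎ Refutable Γ Σ

decided-resp-↭ : Γ ↭ Γ' → Σ ↭ Σ' → Decided Γ Σ → Decided Γ' Σ'
decided-resp-↭ Γ↭Γ' Σ↭Σ' =
  Sum.map (⊢-resp-↭ Γ↭Γ' Σ↭Σ') λ (v , hΓ , hΣ) → v , All-resp-↭ Γ↭Γ' hΓ , All-resp-↭ Σ↭Σ' hΣ

decided-congˡ : a ⊣⊢ b → (∀ v → eval v a ≡ eval v b) → Decided (b ∷ Γ) Σ → Decided (a ∷ Γ) Σ
decided-congˡ (a⊢b , _) a≡b =
  Sum.map (cutˡ a⊢b) λ { (v , hb ∷ hΓ , hΣ) → v , trans (cong designated (a≡b v)) hb ∷ hΓ , hΣ }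

decided-congʳ : a ⊣⊢ b → (∀ v → eval v a ≡ eval v b) → Decided Γ (b ∷ Σ) → Decided Γ (a ∷ Σ)
decided-congʳ (_ , b⊢a) a≡b =
  Sum.map (cutʳ b⊢a) λ { (v , hΓ , hb ∷ hΣ) → v , hΓ , trans (cong designated (a≡b v)) hb ∷ hΣ }

decided-∧ˡ : Decided (a ∷ b ∷ Γ) Σ → Decided (a ∧' b ∷ Γ) Σ
decided-∧ˡ {a = a} {b = b} = Sum.map ∧-l λ { (v , ha ∷ hb ∷ hΓ , hΣ) →
  v , trans (holds-∧ v a b) (cong₂ _∧_ ha hb) ∷ hΓ , hΣ }

decided-∨ʳ : Decided Γ (a ∷ b ∷ Σ) → Decided Γ ((a ∨' b) ∷ Σ)
decided-∨ʳ {a = a} {b = b} = Sum.map ∨-r λ { (v , hΓ , ha ∷ hb ∷ hΣ) →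
  v , hΓ , trans (holds-∨ v a b) (cong₂ _∨_ ha hb) ∷ hΣ }

decided-∨ˡ : Decided (a ∷ Γ) Σ → Decided (b ∷ Γ) Σ → Decided ((a ∨' b) ∷ Γ) Σ
decided-∨ˡ (inj₁ da) (inj₁ db) = inj₁ (∨-l da db)
decided-∨ˡ {a = a} {b = b} (inj₂ (v , ha ∷ hΓ , hΣ)) _ =
  inj₂ (v , trans (holds-∨ v a b) (cong (_∨ holds v b) ha) ∷ hΓ , hΣ)
decided-∨ˡ {a = a} {b = b} (inj₁ _) (inj₂ (v , hb ∷ hΓ , hΣ)) =
  inj₂ (v , trans (holds-∨ v a b) (trans (cong (holds v a ∨_) hb) (∨-zeroʳ (holds v a))) ∷ hΓ , hΣ)

decided-∧ʳ : Decided Γ (a ∷ Σ) → Decided Γ (b ∷ Σ) → Decided Γ (a ∧' b ∷ Σ)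
decided-∧ʳ (inj₁ da) (inj₁ db) = inj₁ (∧-r da db)
decided-∧ʳ {a = a} {b = b} (inj₂ (v , hΓ , ha ∷ hΣ)) _ =
  inj₂ (v , hΓ , trans (holds-∧ v a b) (cong (_∧ holds v b) ha) ∷ hΣ)
decided-∧ʳ {a = a} {b = b} (inj₁ _) (inj₂ (v , hΓ , hb ∷ hΣ)) =
  inj₂ (v , hΓ , trans (holds-∧ v a b) (trans (cong (holds v a ∧_) hb) (∧-zeroʳ (holds v a))) ∷ hΣ)

decided-⊤ˡ : Decided Γ Σ → Decided (⊤' ∷ Γ) Σ
decided-⊤ˡ = Sum.map (weak-l _) λ (v , hΓ , hΣ) → v , refl ∷ hΓ , hΣ

decided-⊥ʳ : Decided Γ Σ → Decided Γ (⊥' ∷ Σ)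
decided-⊥ʳ = Sum.map (weak-r _) λ (v , hΓ , hΣ) → v , hΓ , refl ∷ hΣ

decided-¬∇ˡ : Decided Γ (∇' a ∷ Σ) → Decided (¬' (∇' a) ∷ Γ) Σ
decided-¬∇ˡ {a = a} = Sum.map ¬∇-left λ { (v , hΓ , h∇ ∷ hΣ) →
  v , trans (holds-¬∇ v a) (cong not h∇) ∷ hΓ , hΣ }

decided-¬∇ʳ : Decided (∇' a ∷ Γ) Σ → Decided Γ (¬' (∇' a) ∷ Σ)
decided-¬∇ʳ {a = a} = Sum.map ¬∇-right λ { (v , h∇ ∷ hΓ , hΣ) →
  v , hΓ , trans (holds-¬∇ v a) (cong not h∇) ∷ hΣ }

-- Which of p, ¬p, ∇p, ∇¬p occur on the right of a sequent of literals. A left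
-- literal over p closes the sequent by α ⇒ α or α ⇒ ∇α (closesLeft); the right side
-- alone closes it by the excluded middle for ∇p (closedRight).
Profile : Set
Profile = Bool × Bool × Bool × Bool

infix 8 _∋_
_∋_ : Profile → Kind → Bool
(p , _ , _ , _) ∋ atom   = p
(_ , q , _ , _) ∋ ¬atom  = q
(_ , _ , d , _) ∋ ∇atom  = d
(_ , _ , _ , e) ∋ ∇¬atom = e

closesLeft : Kind → Profile → Bool
closesLeft atom   ρ = ρ ∋ atom ∨ ρ ∋ ∇atom
closesLeft ¬atom  ρ = ρ ∋ ¬atom ∨ ρ ∋ ∇¬atom
closesLeft ∇atom  ρ = ρ ∋ ∇atom
closesLeft ∇¬atom ρ = ρ ∋ ∇¬atom

closedRight : Profile → Bool
closedRight ρ = ρ ∋ ∇atom ∧ (ρ ∋ ∇¬atom ∨ ρ ∋ ¬atom) ∨ ρ ∋ ∇¬atom ∧ ρ ∋ atom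

-- ∇p on the right forces p = 0 and ∇¬p forces p = 1; otherwise p is one of the
-- middle values, chosen so that p and ¬p are designated exactly when absent.
value : Profile → S6
value (_     , _     , true  , _)    = s0
value (_     , _     , false , true) = s1
value (false , false , false , false) = sN
value (true  , false , false , false) = s⅓
value (false , true  , false , false) = s⅔
value (true  , true  , false , false) = sB

value-designated : ∀ k ρ → closesLeft k ρ ≡ false → designated (evalKind k (value ρ)) ≡ true
value-designated k ρ =
  by-exhaustion (λ (k , ρ) → closesLeft k ρ ≟ false →-dec designated (evalKind k (value ρ)) ≟ true) (k , ρ)

value-undesignated : ∀ k ρ → ρ ∋ k ≡ true → closedRight ρ ≡ false →
                     designated (evalKind k (value ρ)) ≡ false
value-undesignated k ρ = by-exhaustion
  (λ (k , ρ) → ρ ∋ k ≟ true →-dec closedRight ρ ≟ false →-dec designated (evalKind k (value ρ)) ≟ false)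
  (k , ρ)

_≟ₗ_ : DecidableEquality Lit
_≟ₗ_ = ≡-dec _≟_ _≟ℕ_

open import Data.List.Membership.DecPropositional _≟ₗ_ using (_∈?_)

profile : List Lit → ℕ → Profile
profile B n = member atom , member ¬atom , member ∇atom , member ∇¬atom
  where
  member : Kind → Bool
  member k = does ((k , n) ∈? B)

∈⇒∋ : ∀ {B k n} → (k , n) ∈ B → profile B n ∋ k ≡ true
∈⇒∋ {B} {atom}   = dec-true (_ ∈? B)
∈⇒∋ {B} {¬atom}  = dec-true (_ ∈? B)
∈⇒∋ {B} {∇atom}  = dec-true (_ ∈? B)
∈⇒∋ {B} {∇¬atom} = dec-true (_ ∈? B)

module _ {A B : List Lit} where

  axiomˡ : ∀ {l l'} → litF l ⊢₁ litF l' → l ∈ A → l' ∈ B → lits A ⊢ lits B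
  axiomˡ d l∈A l'∈B = weaken₁ (∈-map⁺ litF l∈A) (∈-map⁺ litF l'∈B) d

  axiomʳ : ∀ {l l'} → [] ⊢ litF l ∷ litF l' ∷ [] → l ∈ B → l' ∈ B → lits A ⊢ lits B
  axiomʳ d l∈B l'∈B = weaken (λ ()) (pair⊆ (∈-map⁺ litF l∈B) (∈-map⁺ litF l'∈B)) d

  closesLeft⇒⊢ : ∀ k n → (k , n) ∈ A → closesLeft k (profile B n) ≡ true → lits A ⊢ lits B
  closesLeft⇒⊢ atom n l∈A closes with (atom , n) ∈? B | (∇atom , n) ∈? B
  ... | yes p∈B | _      = axiomˡ (ax-id _) l∈A p∈B
  ... | no _    | yes ∇p = axiomˡ (ax-∇ _) l∈A ∇p
  closesLeft⇒⊢ atom n l∈A () | no _ | no _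
  closesLeft⇒⊢ ¬atom n l∈A closes with (¬atom , n) ∈? B | (∇¬atom , n) ∈? B
  ... | yes ¬p∈B | _       = axiomˡ (ax-id _) l∈A ¬p∈B
  ... | no _     | yes ∇¬p = axiomˡ (ax-∇ _) l∈A ∇¬p
  closesLeft⇒⊢ ¬atom n l∈A () | no _ | no _
  closesLeft⇒⊢ ∇atom n l∈A closes with (∇atom , n) ∈? B
  ... | yes ∇p = axiomˡ (ax-id _) l∈A ∇p
  closesLeft⇒⊢ ∇atom n l∈A () | no _
  closesLeft⇒⊢ ∇¬atom n l∈A closes with (∇¬atom , n) ∈? B
  ... | yes ∇¬p = axiomˡ (ax-id _) l∈A ∇¬p
  closesLeft⇒⊢ ∇¬atom n l∈A () | no _

  closedRight⇒⊢ : ∀ n → closedRight (profile B n) ≡ true → lits A ⊢ lits B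
  closedRight⇒⊢ n closed with (∇atom , n) ∈? B | (∇¬atom , n) ∈? B | (¬atom , n) ∈? B | (atom , n) ∈? B
  ... | yes ∇p | yes ∇¬p | _      | _     = axiomʳ ⊢-∇-∇¬ ∇p ∇¬p
  ... | yes ∇p | no _    | yes ¬p | _     = axiomʳ ⊢-∇-¬ ∇p ¬p
  ... | no _   | yes ∇¬p | _      | yes p = axiomʳ ⊢-∇¬-id ∇¬p p
  closedRight⇒⊢ n () | yes _ | no _  | no _ | _
  closedRight⇒⊢ n () | no _  | yes _ | _    | no _
  closedRight⇒⊢ n () | no _  | no _  | _    | _

decideLiterals : (A B : List Lit) → Decided (lits A) (lits B)
decideLiterals A B
  with any? (λ (_ , n) → closedRight (profile B n) ≟ true) B
     | any? (λ (k , n) → closesLeft k (profile B n) ≟ true) A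
... | yes closed | _ = let (_ , n) , c = satisfied closed in inj₁ (closedRight⇒⊢ n c)
... | no _ | yes closes = let (k , n) , l∈A , c = find closes in inj₁ (closesLeft⇒⊢ k n l∈A c)
... | no ¬closed | no ¬closes = inj₂ (v , map⁺ (All.tabulate left-true) , map⁺ (All.tabulate right-false))
  where
  v : ℕ → S6
  v n = value (profile B n)

  left-true : ∀ {l} → l ∈ A → holds v (litF l) ≡ true
  left-true {k , n} l∈A =
    trans (cong designated (eval-litF v k n)) (value-designated k _ (¬-not λ c → ¬closes (lose l∈A c)))

  right-false : ∀ {l} → l ∈ B → holds v (litF l) ≡ false
  right-false {k , n} l∈B = trans (cong designated (eval-litF v k n))
    (value-undesignated k _ (∈⇒∋ l∈B) (¬-not λ c → ¬closed (lose l∈B c)))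

-- Proof search

-- Decomposing a formula leaves literals behind; a decider settles the rest of the
-- sequent whatever literals it is extended by.
Decider : List Formula → List Formula → Set
Decider Γ Σ = (A B : List Lit) → Decided (lits A ++ Γ) (lits B ++ Σ)

extend : Decider Γ Σ → (A B : List Lit) → Decider (lits A ++ Γ) (lits B ++ Σ)
extend {Γ} {Σ} decider A B A' B' =
  subst₂ Decided (lits-++ A' A Γ) (lits-++ B' B Σ) (decider (A' ++ A) (B' ++ B))
  where
  lits-++ : ∀ A' A Γ → lits (A' ++ A) ++ Γ ≡ lits A' ++ lits A ++ Γ
  lits-++ A' A Γ = trans (cong (_++ Γ) (map-++ litF A' A)) (++-assoc (lits A') (lits A) Γ)

decideˡ : (x : NNF) → Decider Γ Σ → Decided (⌊ x ⌋ ∷ Γ) Σ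
decideʳ : (x : NNF) → Decider Γ Σ → Decided Γ (⌊ x ⌋ ∷ Σ)

decideˡ (lit l)     decider = decider [ l ] []
decideˡ (¬∇atom n)  decider = decided-¬∇ˡ (decider [] [ ∇atom , n ])
decideˡ (¬∇¬atom n) decider = decided-¬∇ˡ (decider [] [ ∇¬atom , n ])
decideˡ (x ∧ₙ y)    decider = decided-∧ˡ (decideˡ x λ A B →
  decided-resp-↭ (↭-sym (shift _ (lits A) _)) ↭-refl (decideˡ y (extend decider A B)))
decideˡ (x ∨ₙ y)    decider = decided-∨ˡ (decideˡ x decider) (decideˡ y decider)
decideˡ ⊤ₙ          decider = decided-⊤ˡ (decider [] [])
decideˡ ⊥ₙ          decider = inj₁ (weaken (single⊆ (here refl)) (λ ()) ax-⊥)

decideʳ (lit l)     decider = decider [] [ l ]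
decideʳ (¬∇atom n)  decider = decided-¬∇ʳ (decider [ ∇atom , n ] [])
decideʳ (¬∇¬atom n) decider = decided-¬∇ʳ (decider [ ∇¬atom , n ] [])
decideʳ (x ∧ₙ y)    decider = decided-∧ʳ (decideʳ x decider) (decideʳ y decider)
decideʳ (x ∨ₙ y)    decider = decided-∨ʳ (decideʳ x λ A B →
  decided-resp-↭ ↭-refl (↭-sym (shift _ (lits B) _)) (decideʳ y (extend decider A B)))
decideʳ ⊤ₙ          decider = inj₁ (weaken (λ ()) (single⊆ (here refl)) ax-⊤)
decideʳ ⊥ₙ          decider = decided-⊥ʳ (decider [] [])

decide : (Γ Σ : List Formula) → Decider Γ Σ
decide [] [] A B =
  subst₂ Decided (sym (++-identityʳ (lits A))) (sym (++-identityʳ (lits B))) (decideLiterals A B)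
decide [] (b ∷ Σ) A B =
  decided-resp-↭ ↭-refl (↭-sym (shift b (lits B) Σ))
    (decided-congʳ (nnf-equiv b) (λ v → sym (eval-nnf v b)) (decideʳ (nnf b) (extend (decide [] Σ) A B)))
decide (a ∷ Γ) Σ A B =
  decided-resp-↭ (↭-sym (shift a (lits A) Γ)) ↭-refl
    (decided-congˡ (nnf-equiv a) (λ v → sym (eval-nnf v a)) (decideˡ (nnf a) (extend (decide Γ Σ) A B)))

mainTheorem19 : (Γ Σ : List Formula) → Valid Γ Σ → Γ ⊢ Σ
mainTheorem19 Γ Σ valid = fromInj₁ (λ refuted → ⊥-elim (refutable⇒invalid refuted valid)) (decide Γ Σ [] [])
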